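{- Let $n\ge4$, $0\le m\le\binom n2$, and $k=\binom n2-m$. If $k\le n/2$, then $\Theta_{n+1}(m+n)=\Theta_n(m)$.
   Context: All graphs are finite, simple and undirected. A clique cover of $G=(V,E)$ is a family of vertex sets, each inducing a clique, whose union is $V$ and such that every edge lies in some member. $\theta(G)$ is the minimum size of a clique cover of $G$. For $0\le m\le\binom n2$, $\Theta_n(m)$ is the maximum of $\theta(G)$ over all graphs $G$ with $n$ vertices and $m$ edges. -}

module Defs where

open import Data.Nat using (ℕ; _≤_; _<ᵇ_)
open import Data.Bool using (Bool; true; false; _∧_; if_then_else_)
open import Data.Fin using (Fin; toℕ)
open import Data.Fin.Subset using (Subset; _∈_)
open import Data.List using (List; length; map; allFin)
open import Data.Nat.ListAction using (sum)
open import Data.List.Membership.Propositional renaming (_∈_ to _∈ˡ_)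
open import Data.Product using (Σ; ∃; _×_)
open import Relation.Binary.PropositionalEquality using (_≡_; _≢_)

record Graph (n : ℕ) : Set where
  field
    adj    : Fin n → Fin n → Bool
    sym    : ∀ i j → adj i j ≡ adj j i
    irrefl : ∀ i → adj i i ≡ false
open Graph public

edgeCount : ∀ {n} → Graph n → ℕ
edgeCount {n} G =
  sum (map (λ i → sum (map (λ j → if (toℕ i <ᵇ toℕ j) ∧ adj G i j then 1 else 0)
                            (allFin n)))
           (allFin n))

IsClique : ∀ {n} → Graph n → Subset n → Set
IsClique G C = ∀ i j → i ∈ C → j ∈ C → i ≢ j → adj G i j ≡ true

record IsCliqueCover {n} (G : Graph n) (𝒞 : List (Subset n)) : Set where
  field
    cliques     : ∀ C → C ∈ˡ 𝒞 → IsClique G C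
    coversVerts : ∀ v → ∃ λ C → C ∈ˡ 𝒞 × v ∈ C
    coversEdges : ∀ i j → adj G i j ≡ true → ∃ λ C → C ∈ˡ 𝒞 × i ∈ C × j ∈ C

IsTheta : ∀ {n} → Graph n → ℕ → Set
IsTheta {n} G t =
  (Σ (List (Subset n)) λ 𝒞 → IsCliqueCover G 𝒞 × length 𝒞 ≡ t)
  × (∀ 𝒞 → IsCliqueCover G 𝒞 → t ≤ length 𝒞)

IsBigTheta : ℕ → ℕ → ℕ → Set
IsBigTheta n m t =
  (Σ (Graph n) λ G → edgeCount G ≡ m × IsTheta G t)
  × (∀ (G : Graph n) → edgeCount G ≡ m →
       Σ (List (Subset n)) λ 𝒞 → IsCliqueCover G 𝒞 × length 𝒞 ≤ t)

-- If k = C(n,2) − m ≤ n/2, a graph on n + 1 vertices with m + n edges misses only k edges,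
-- so fewer than n + 1 vertices lie on a non-edge and some vertex is universal; deleting it
-- leaves a graph with m edges. Conversely adding a universal vertex to a graph with m edges
-- gives m + n edges. Adding or deleting a universal vertex does not change θ, since clique
-- covers correspond by adjoining the apex to, or deleting it from, every clique.
module Submission where

open import Defs
open import Data.Bool using (Bool; true; false; _∧_; if_then_else_)
open import Data.Empty using (⊥-elim)
open import Data.Fin as Fin using (Fin; zero; suc; toℕ; punchIn; punchOut)
open import Data.Fin.Properties
  using (toℕ-injective; punchIn-injective; punchInᵢ≢i; punchIn-punchOut; punchOut-punchIn; any?)
open import Data.Fin.Subset using (Subset; _∈_)
open import Data.List using (List; map; length; tabulate; allFin)
open import Data.List.Properties using (length-map)
open import Data.List.Membership.Propositional.Properties using (∈-map⁺; ∈-map⁻)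
open import Data.Nat
open import Data.Nat.Properties
open import Data.Nat.Combinatorics using (_C_; nC1≡n; nCk+nC[k+1]≡[n+1]C[k+1])
open import Data.Nat.ListAction using () renaming (sum to listSum)
open import Data.Nat.Tactic.RingSolver using (solve-∀)
open import Data.Product using (Σ; ∃; _×_; _,_)
open import Data.Vec using (Vec; lookup; insertAt; removeAt)
open import Data.Vec.Properties
  using (insertAt-lookup; insertAt-punchIn; removeAt-punchOut; []=⇒lookup; lookup⇒[]=)
open import Function using (_∘_)
open import Function.Bundles using (_⇔_; mk⇔; Equivalence)
open import Relation.Binary.PropositionalEquality hiding (sym)
open import Relation.Binary.PropositionalEquality as ≡ using ()
open import Relation.Nullary using (yes; no)
open import Relation.Nullary.Reflects using (ofʸ; ofⁿ)

open import Algebra.Properties.CommutativeMonoid.Sum +-0-commutativeMonoid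
  using (sum-syntax; sum-cong-≗; ∑-distrib-+; ∑-comm; sum-remove)

𝟙 : Bool → ℕ
𝟙 b = if b then 1 else 0

𝟙≤1 : ∀ b → 𝟙 b ≤ 1
𝟙≤1 true  = ≤-refl
𝟙≤1 false = z≤n

∑-const : ∀ n c → ∑[ i < n ] c ≡ n * c
∑-const zero    c = refl
∑-const (suc n) c = cong (c +_) (∑-const n c)

∑-ones : ∀ n → ∑[ i < n ] 1 ≡ n
∑-ones n = trans (∑-const n 1) (*-identityʳ n)

∑-mono-≤ : ∀ {n} {f g : Fin n → ℕ} → (∀ i → f i ≤ g i) → ∑[ i < n ] f i ≤ ∑[ i < n ] g i
∑-mono-≤ {zero}  f≤g = z≤n
∑-mono-≤ {suc n} f≤g = +-mono-≤ (f≤g zero) (∑-mono-≤ (f≤g ∘ suc))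

∑-𝟙-≤ : ∀ n (b : Fin n → Bool) → ∑[ i < n ] 𝟙 (b i) ≤ n
∑-𝟙-≤ zero    b = z≤n
∑-𝟙-≤ (suc n) b = +-mono-≤ (𝟙≤1 (b zero)) (∑-𝟙-≤ n (b ∘ suc))

∑-𝟙-< : ∀ n (b : Fin n → Bool) w → b w ≡ false → ∑[ i < n ] 𝟙 (b i) < n
∑-𝟙-< (suc n) b zero    bw rewrite bw = s≤s (∑-𝟙-≤ n (b ∘ suc))
∑-𝟙-< (suc n) b (suc w) bw = +-mono-≤-< (𝟙≤1 (b zero)) (∑-𝟙-< n (b ∘ suc) w bw)

listSum-map-tabulate : ∀ {A : Set} n (g : Fin n → A) (f : A → ℕ) →
  listSum (map f (tabulate g)) ≡ ∑[ i < n ] f (g i)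
listSum-map-tabulate zero    g f = refl
listSum-map-tabulate (suc n) g f = cong (f (g zero) +_) (listSum-map-tabulate n (g ∘ suc) f)

listSum-map-allFin : ∀ n (f : Fin n → ℕ) → listSum (map f (allFin n)) ≡ ∑[ i < n ] f i
listSum-map-allFin n = listSum-map-tabulate n (λ i → i)

degree : ∀ {n} → Graph n → Fin n → ℕ
degree {n} G u = ∑[ v < n ] 𝟙 (adj G u v)

IsUniversal : ∀ {n} → Graph n → Fin n → Set
IsUniversal G u = ∀ v → u ≢ v → adj G u v ≡ true

module _ {n} (G : Graph n) where

  edgeCount≡∑ : edgeCount G ≡ ∑[ i < n ] ∑[ j < n ] 𝟙 ((toℕ i <ᵇ toℕ j) ∧ adj G i j)
  edgeCount≡∑ = trans (listSum-map-allFin n _) (sum-cong-≗ (λ i → listSum-map-allFin n (λ j → 𝟙 ((toℕ i <ᵇ toℕ j) ∧ adj G i j))))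

  𝟙-adj-split : ∀ i j →
    𝟙 (adj G i j) ≡ 𝟙 ((toℕ i <ᵇ toℕ j) ∧ adj G i j) + 𝟙 ((toℕ j <ᵇ toℕ i) ∧ adj G j i)
  𝟙-adj-split i j
    with toℕ i <ᵇ toℕ j | <ᵇ-reflects-< (toℕ i) (toℕ j)
       | toℕ j <ᵇ toℕ i | <ᵇ-reflects-< (toℕ j) (toℕ i)
  ... | true  | ofʸ i<j | true  | ofʸ j<i = ⊥-elim (<-asym i<j j<i)
  ... | true  | _       | false | _       = ≡.sym (+-identityʳ _)
  ... | false | _       | true  | _       = cong 𝟙 (sym G i j)
  ... | false | ofⁿ i≮j | false | ofⁿ j≮i
    with toℕ-injective (≤-antisym (≮⇒≥ j≮i) (≮⇒≥ i≮j))
  ... | refl = cong 𝟙 (irrefl G i)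

  handshake : ∑[ u < n ] degree G u ≡ 2 * edgeCount G
  handshake = begin
    ∑[ i < n ] ∑[ j < n ] 𝟙 (adj G i j)
      ≡⟨ sum-cong-≗ (λ i → sum-cong-≗ (𝟙-adj-split i)) ⟩
    ∑[ i < n ] ∑[ j < n ] (f i j + f j i)
      ≡⟨ sum-cong-≗ (λ i → ∑-distrib-+ (f i) (λ j → f j i)) ⟩
    ∑[ i < n ] (∑[ j < n ] f i j + ∑[ j < n ] f j i)
      ≡⟨ ∑-distrib-+ (λ i → ∑[ j < n ] f i j) (λ i → ∑[ j < n ] f j i) ⟩
    e + ∑[ i < n ] ∑[ j < n ] f j i
      ≡⟨ cong (e +_) (∑-comm (λ i j → f j i)) ⟩
    e + e
      ≡⟨ cong₂ _+_ edgeCount≡∑ edgeCount≡∑ ⟨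
    edgeCount G + edgeCount G
      ≡⟨ cong (edgeCount G +_) (+-identityʳ _) ⟨
    2 * edgeCount G ∎
    where
    open ≡-Reasoning
    f : Fin n → Fin n → ℕ
    f i j = 𝟙 ((toℕ i <ᵇ toℕ j) ∧ adj G i j)
    e = ∑[ i < n ] ∑[ j < n ] f i j

module _ {n} (G : Graph (suc n)) where

  degree≡∑-punchIn : ∀ u → degree G u ≡ ∑[ v < n ] 𝟙 (adj G u (punchIn u v))
  degree≡∑-punchIn u = trans (sum-remove {i = u} (𝟙 ∘ adj G u)) (cong (λ b → 𝟙 b + ∑[ v < n ] 𝟙 (adj G u (punchIn u v))) (irrefl G u))

  degree≤ : ∀ u → degree G u ≤ n
  degree≤ u = subst (_≤ n) (≡.sym (degree≡∑-punchIn u)) (∑-𝟙-≤ n _)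

  degree<-nonadjacent : ∀ {u v} → u ≢ v → adj G u v ≡ false → degree G u < n
  degree<-nonadjacent {u} u≢v uv = subst (_< n) (≡.sym (degree≡∑-punchIn u))
    (∑-𝟙-< n _ (punchOut u≢v) (trans (cong (adj G u) (punchIn-punchOut u≢v)) uv))

  universal-if-degree≡ : ∀ {u} → degree G u ≡ n → IsUniversal G u
  universal-if-degree≡ {u} deg≡n v u≢v with adj G u v in uv
  ... | true  = refl
  ... | false = ⊥-elim (<-irrefl deg≡n (degree<-nonadjacent u≢v uv))

  -- The hypothesis says that twice the number of non-edges is less than the number of vertices.
  universal-exists : suc n * n < suc n + 2 * edgeCount G → ∃ (IsUniversal G)
  universal-exists dense with any? (λ u → degree G u ≟ n)
  ... | yes (u , deg≡n) = u , universal-if-degree≡ deg≡n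
  ... | no ¬deg≡n = ⊥-elim (<-irrefl refl (<-≤-trans dense bound))
    where
    open ≤-Reasoning
    bound : suc n + 2 * edgeCount G ≤ suc n * n
    bound = begin
      suc n + 2 * edgeCount G
        ≡⟨ cong₂ _+_ (∑-ones (suc n)) (handshake G) ⟨
      ∑[ u < suc n ] 1 + ∑[ u < suc n ] degree G u
        ≡⟨ ∑-distrib-+ (λ _ → 1) (degree G) ⟨
      ∑[ u < suc n ] suc (degree G u)
        ≤⟨ ∑-mono-≤ (λ u → ≤∧≢⇒< (degree≤ u) (λ deg≡n → ¬deg≡n (u , deg≡n))) ⟩
      ∑[ u < suc n ] n
        ≡⟨ ∑-const (suc n) n ⟩
      suc n * n ∎

IsVertexDeleted : ∀ {n} → Graph (suc n) → Fin (suc n) → Graph n → Set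
IsVertexDeleted {n} G' u G = ∀ (i j : Fin n) → adj G' (punchIn u i) (punchIn u j) ≡ adj G i j

record IsCone {n} (G' : Graph (suc n)) (u : Fin (suc n)) (G : Graph n) : Set where
  field
    apex-universal : IsUniversal G' u
    base-deleted   : IsVertexDeleted G' u G
open IsCone

removeVertex : ∀ {n} → Graph (suc n) → Fin (suc n) → Graph n
removeVertex G' u = record
  { adj    = λ i j → adj G' (punchIn u i) (punchIn u j)
  ; sym    = λ i j → sym G' _ _
  ; irrefl = λ i → irrefl G' _
  }

removeVertex-isCone : ∀ {n} {G' : Graph (suc n)} {u} → IsUniversal G' u →
  IsCone G' u (removeVertex G' u)
removeVertex-isCone universal = record { apex-universal = universal ; base-deleted = λ i j → refl }

module _ {n} (G : Graph n) where

  coneAdj : Fin (suc n) → Fin (suc n) → Bool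
  coneAdj zero    zero    = false
  coneAdj zero    (suc j) = true
  coneAdj (suc i) zero    = true
  coneAdj (suc i) (suc j) = adj G i j

  coneAdj-sym : ∀ i j → coneAdj i j ≡ coneAdj j i
  coneAdj-sym zero    zero    = refl
  coneAdj-sym zero    (suc j) = refl
  coneAdj-sym (suc i) zero    = refl
  coneAdj-sym (suc i) (suc j) = sym G i j

  coneAdj-irrefl : ∀ i → coneAdj i i ≡ false
  coneAdj-irrefl zero    = refl
  coneAdj-irrefl (suc i) = irrefl G i

  cone : Graph (suc n)
  cone = record { adj = coneAdj ; sym = coneAdj-sym ; irrefl = coneAdj-irrefl }

  cone-isCone : IsCone cone zero G
  cone-isCone = record { apex-universal = universal ; base-deleted = λ i j → refl }
    where
    universal : IsUniversal cone zero
    universal zero    0≢0 = ⊥-elim (0≢0 refl)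
    universal (suc v) _   = refl

edgeCount-cone : ∀ {n} {G' : Graph (suc n)} {u G} → IsCone G' u G → edgeCount G' ≡ edgeCount G + n
edgeCount-cone {n} {G'} {u} {G} c = *-cancelˡ-≡ _ _ 2 (begin
  2 * edgeCount G'                                  ≡⟨ handshake G' ⟨
  ∑[ v < suc n ] degree G' v                        ≡⟨ sum-remove {i = u} (degree G') ⟩
  degree G' u + ∑[ i < n ] degree G' (punchIn u i)  ≡⟨ cong₂ _+_ degree-apex (sum-cong-≗ degree-base) ⟩
  n + ∑[ i < n ] (1 + degree G i)                   ≡⟨ cong (n +_) (∑-distrib-+ (λ _ → 1) (degree G)) ⟩
  n + (∑[ i < n ] 1 + ∑[ i < n ] degree G i)        ≡⟨ cong₂ (λ a b → n + (a + b)) (∑-ones n) (handshake G) ⟩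
  n + (n + 2 * edgeCount G)                         ≡⟨ rearrange n (edgeCount G) ⟩
  2 * (edgeCount G + n)                             ∎)
  where
  open ≡-Reasoning
  rearrange : ∀ n e → n + (n + 2 * e) ≡ 2 * (e + n)
  rearrange = solve-∀
  apex≢punchIn : ∀ i → u ≢ punchIn u i
  apex≢punchIn i = punchInᵢ≢i u i ∘ ≡.sym
  degree-apex : degree G' u ≡ n
  degree-apex = begin
    degree G' u                                 ≡⟨ degree≡∑-punchIn G' u ⟩
    ∑[ i < n ] 𝟙 (adj G' u (punchIn u i))       ≡⟨ sum-cong-≗ (λ i → cong 𝟙 (apex-universal c _ (apex≢punchIn i))) ⟩
    ∑[ i < n ] 1                                ≡⟨ ∑-ones n ⟩
    n                                           ∎
  degree-base : ∀ i → degree G' (punchIn u i) ≡ 1 + degree G i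
  degree-base i = begin
    degree G' (punchIn u i)
      ≡⟨ sum-remove {i = u} (𝟙 ∘ adj G' (punchIn u i)) ⟩
    𝟙 (adj G' (punchIn u i) u) + ∑[ j < n ] 𝟙 (adj G' (punchIn u i) (punchIn u j))
      ≡⟨ cong₂ _+_ apex-adjacent (sum-cong-≗ (cong 𝟙 ∘ base-deleted c i)) ⟩
    1 + degree G i ∎
    where
    apex-adjacent : 𝟙 (adj G' (punchIn u i) u) ≡ 1
    apex-adjacent = cong 𝟙 (trans (sym G' _ _) (apex-universal c _ (apex≢punchIn i)))

lookup-removeAt : ∀ {A : Set} {n} (xs : Vec A (suc n)) u v →
  lookup (removeAt xs u) v ≡ lookup xs (punchIn u v)
lookup-removeAt xs u v =
  trans (cong (lookup (removeAt xs u)) (≡.sym (punchOut-punchIn u))) (removeAt-punchOut xs _)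

module _ {n} (u : Fin (suc n)) where

  ∈-insertAt : ∀ {K : Subset n} {v} → v ∈ K → punchIn u v ∈ insertAt K u true
  ∈-insertAt {K} {v} v∈K = lookup⇒[]= _ _ (trans (insertAt-punchIn K u true v) ([]=⇒lookup v∈K))

  ∈-insertAt⁻ : ∀ {K : Subset n} {v} → punchIn u v ∈ insertAt K u true → v ∈ K
  ∈-insertAt⁻ {K} {v} v∈K = lookup⇒[]= _ _ (trans (≡.sym (insertAt-punchIn K u true v)) ([]=⇒lookup v∈K))

  apex-∈-insertAt : ∀ (K : Subset n) → u ∈ insertAt K u true
  apex-∈-insertAt K = lookup⇒[]= u _ (insertAt-lookup K u true)

  ∈-removeAt : ∀ {K : Subset (suc n)} {v} → punchIn u v ∈ K → v ∈ removeAt K u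
  ∈-removeAt {K} {v} v∈K = lookup⇒[]= _ _ (trans (lookup-removeAt K u v) ([]=⇒lookup v∈K))

  ∈-removeAt⁻ : ∀ {K : Subset (suc n)} {v} → v ∈ removeAt K u → punchIn u v ∈ K
  ∈-removeAt⁻ {K} {v} v∈K = lookup⇒[]= _ _ (trans (≡.sym (lookup-removeAt K u v)) ([]=⇒lookup v∈K))

  data PunchInView : Fin (suc n) → Set where
    apex    : PunchInView u
    punched : ∀ v → PunchInView (punchIn u v)

  punchInView : ∀ v → PunchInView v
  punchInView v with u Fin.≟ v
  ... | yes refl = apex
  ... | no u≢v   = subst PunchInView (punchIn-punchOut u≢v) (punched _)

open IsCliqueCover

restrict-cover : ∀ {n} {G' : Graph (suc n)} {u G} → IsVertexDeleted G' u G →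
  ∀ {𝒞} → IsCliqueCover G' 𝒞 → IsCliqueCover G (map (λ K → removeAt K u) 𝒞)
cliques (restrict-cover {u = u} deleted cover) _ K∈ i j i∈ j∈ i≢j with ∈-map⁻ _ K∈
... | K , K∈𝒞 , refl = trans (≡.sym (deleted i j))
  (cliques cover K K∈𝒞 _ _ (∈-removeAt⁻ u i∈) (∈-removeAt⁻ u j∈) (i≢j ∘ punchIn-injective u i j))
coversVerts (restrict-cover {u = u} deleted cover) v with coversVerts cover (punchIn u v)
... | K , K∈𝒞 , v∈ = _ , ∈-map⁺ _ K∈𝒞 , ∈-removeAt u v∈
coversEdges (restrict-cover {u = u} deleted cover) i j ij
  with coversEdges cover (punchIn u i) (punchIn u j) (trans (deleted i j) ij)
... | K , K∈𝒞 , i∈ , j∈ = _ , ∈-map⁺ _ K∈𝒞 , ∈-removeAt u i∈ , ∈-removeAt u j∈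

-- The apex is covered by adding it to a clique containing the base vertex w; without such a
-- vertex the empty cover of the empty graph would not extend.
extend-cover : ∀ {n} {G' : Graph (suc n)} {u G} → IsCone G' u G → Fin n →
  ∀ {𝒞} → IsCliqueCover G 𝒞 → IsCliqueCover G' (map (λ K → insertAt K u true) 𝒞)
cliques (extend-cover {G' = G'} {u} c w cover) _ K∈ i j i∈ j∈ i≢j with ∈-map⁻ _ K∈
... | K , K∈𝒞 , refl with punchInView u i | punchInView u j
... | apex        | apex        = ⊥-elim (i≢j refl)
... | apex        | punched _   = apex-universal c _ i≢j
... | punched _   | apex        = trans (sym G' _ _) (apex-universal c _ (i≢j ∘ ≡.sym))
... | punched i₀  | punched j₀  = trans (base-deleted c i₀ j₀)
  (cliques cover K K∈𝒞 i₀ j₀ (∈-insertAt⁻ u i∈) (∈-insertAt⁻ u j∈) (i≢j ∘ cong (punchIn u)))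
coversVerts (extend-cover {u = u} c w cover) v with punchInView u v
... | apex with coversVerts cover w
...   | K , K∈𝒞 , _ = _ , ∈-map⁺ _ K∈𝒞 , apex-∈-insertAt u K
coversVerts (extend-cover {u = u} c w cover) v | punched v₀ with coversVerts cover v₀
...   | K , K∈𝒞 , v∈ = _ , ∈-map⁺ _ K∈𝒞 , ∈-insertAt u v∈
coversEdges (extend-cover {G' = G'} {u} c w cover) i j ij with punchInView u i | punchInView u j
... | apex | apex with () ← trans (≡.sym ij) (irrefl G' u)
... | apex | punched j₀ with coversVerts cover j₀
...   | K , K∈𝒞 , j∈ = _ , ∈-map⁺ _ K∈𝒞 , apex-∈-insertAt u K , ∈-insertAt u j∈
coversEdges (extend-cover {u = u} c w cover) i j ij | punched i₀ | apex with coversVerts cover i₀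
...   | K , K∈𝒞 , i∈ = _ , ∈-map⁺ _ K∈𝒞 , ∈-insertAt u i∈ , apex-∈-insertAt u K
coversEdges (extend-cover {u = u} c w cover) i j ij | punched i₀ | punched j₀
  with coversEdges cover i₀ j₀ (trans (≡.sym (base-deleted c i₀ j₀)) ij)
...   | K , K∈𝒞 , i∈ , j∈ = _ , ∈-map⁺ _ K∈𝒞 , ∈-insertAt u i∈ , ∈-insertAt u j∈

CoveredWithin : ∀ {n} → Graph n → ℕ → Set
CoveredWithin {n} G t = Σ (List (Subset n)) λ 𝒞 → IsCliqueCover G 𝒞 × length 𝒞 ≤ t

module _ {n} {G' : Graph (suc n)} {u G} (c : IsCone G' u G) (w : Fin n) (t : ℕ) where

  coveredWithin-cone : CoveredWithin G t ⇔ CoveredWithin G' t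
  coveredWithin-cone = mk⇔
    (λ (𝒞 , cover , ≤t) → _ , extend-cover c w cover , subst (_≤ t) (≡.sym (length-map _ 𝒞)) ≤t)
    (λ (𝒞 , cover , ≤t) → _ , restrict-cover (base-deleted c) cover , subst (_≤ t) (≡.sym (length-map _ 𝒞)) ≤t)

  isTheta-cone : IsTheta G t ⇔ IsTheta G' t
  isTheta-cone = mk⇔
    (λ ((𝒞 , cover , ≡t) , minimal) →
      (_ , extend-cover c w cover , trans (length-map _ 𝒞) ≡t)
      , λ 𝒟 cover′ → subst (t ≤_) (length-map _ 𝒟) (minimal _ (restrict-cover (base-deleted c) cover′)))
    (λ ((𝒞 , cover , ≡t) , minimal) →
      (_ , restrict-cover (base-deleted c) cover , trans (length-map _ 𝒞) ≡t)
      , λ 𝒟 cover′ → subst (t ≤_) (length-map _ 𝒟) (minimal _ (extend-cover c w cover′)))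

bigTheta-cone : ∀ {n m} → Fin n → (∀ (G' : Graph (suc n)) → edgeCount G' ≡ m + n → ∃ (IsUniversal G')) →
  ∀ t → IsBigTheta n m t ⇔ IsBigTheta (suc n) (m + n) t
bigTheta-cone {n} {m} w has-universal t = mk⇔ to from
  where
  coneOver : ∀ G' → edgeCount G' ≡ m + n →
    Σ (Fin (suc n)) λ u → IsCone G' u (removeVertex G' u) × edgeCount (removeVertex G' u) ≡ m
  coneOver G' edges with has-universal G' edges
  ... | u , universal = u , c , +-cancelʳ-≡ n _ _ (trans (≡.sym (edgeCount-cone c)) edges)
    where c = removeVertex-isCone universal

  coneEdges : ∀ G → edgeCount G ≡ m → edgeCount (cone G) ≡ m + n
  coneEdges G edges = trans (edgeCount-cone (cone-isCone G)) (cong (_+ n) edges)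

  to : IsBigTheta n m t → IsBigTheta (suc n) (m + n) t
  to ((G , edges , θ) , covered) =
    (cone G , coneEdges G edges , Equivalence.to (isTheta-cone (cone-isCone G) w t) θ)
    , λ G' edges′ → let (u , c , base-edges) = coneOver G' edges′
                    in Equivalence.to (coveredWithin-cone c w t) (covered _ base-edges)

  from : IsBigTheta (suc n) (m + n) t → IsBigTheta n m t
  from ((G' , edges , θ) , covered) =
    let (u , c , base-edges) = coneOver G' edges
    in (removeVertex G' u , base-edges , Equivalence.from (isTheta-cone c w t) θ)
       , λ G edges′ → Equivalence.from (coveredWithin-cone (cone-isCone G) w t) (covered _ (coneEdges G edges′))

2*[1+n]C2≡[1+n]*n : ∀ p → 2 * (suc p C 2) ≡ suc p * p
2*[1+n]C2≡[1+n]*n zero    = refl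
2*[1+n]C2≡[1+n]*n (suc p) = begin
  2 * (suc (suc p) C 2)          ≡⟨ cong (2 *_) (nCk+nC[k+1]≡[n+1]C[k+1] (suc p) 1) ⟨
  2 * (suc p C 1 + suc p C 2)    ≡⟨ cong (λ x → 2 * (x + suc p C 2)) (nC1≡n (suc p)) ⟩
  2 * (suc p + suc p C 2)        ≡⟨ *-distribˡ-+ 2 (suc p) _ ⟩
  2 * suc p + 2 * (suc p C 2)    ≡⟨ cong (2 * suc p +_) (2*[1+n]C2≡[1+n]*n p) ⟩
  2 * suc p + suc p * p          ≡⟨ rearrange p ⟩
  suc (suc p) * suc p            ∎
  where
  open ≡-Reasoning
  rearrange : ∀ p → 2 * suc p + suc p * p ≡ suc (suc p) * suc p
  rearrange = solve-∀

few-non-edges : ∀ p m → m ≤ suc p C 2 → 2 * (suc p C 2 ∸ m) ≤ suc p →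
  suc (suc p) * suc p < suc (suc p) + 2 * (m + suc p)
few-non-edges p m m≤ 2k≤n = begin-strict
  suc (suc p) * suc p               ≡⟨ expand p ⟩
  suc p * p + 2 * suc p             ≡⟨ cong (_+ 2 * suc p) twice-total ⟨
  2 * m + 2 * k + 2 * suc p         ≤⟨ +-monoˡ-≤ (2 * suc p) (+-monoʳ-≤ (2 * m) 2k≤n) ⟩
  2 * m + suc p + 2 * suc p         <⟨ ≤-reflexive (collect p m) ⟩
  suc (suc p) + 2 * (m + suc p)     ∎
  where
  open ≤-Reasoning
  k = suc p C 2 ∸ m
  twice-total : 2 * m + 2 * k ≡ suc p * p
  twice-total = trans (≡.sym (*-distribˡ-+ 2 m k)) (trans (cong (2 *_) (m+[n∸m]≡n m≤)) (2*[1+n]C2≡[1+n]*n p))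
  expand : ∀ p → suc (suc p) * suc p ≡ suc p * p + 2 * suc p
  expand = solve-∀
  collect : ∀ p m → suc (2 * m + suc p + 2 * suc p) ≡ suc (suc p) + 2 * (m + suc p)
  collect = solve-∀

lemma18 : ∀ (n m : ℕ) → 4 ≤ n → m ≤ n C 2 →
    2 * (n C 2 ∸ m) ≤ n →
    ∀ (t : ℕ) → IsBigTheta n m t ⇔ IsBigTheta (suc n) (m + n) t
lemma18 (suc p) m _ m≤ 2k≤n = bigTheta-cone zero has-universal
  where
  has-universal : ∀ G' → edgeCount G' ≡ m + suc p → ∃ (IsUniversal G')
  has-universal G' edges =
    universal-exists G' (subst (λ e → suc (suc p) * suc p < suc (suc p) + 2 * e) (≡.sym edges) (few-non-edges p m m≤ 2k≤n))
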